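{- For all formulas $V,F$ of LD: (a) $(V\bullet *V)\equiv +V$ is a theorem of LD; (b) $(\sim F\bullet *F)\equiv\neg F$ is a theorem of LD.
   Context: Logic LD. Atoms: classical atoms $a,b,\dots$ and alternate atoms $\underline a,\underline b,\dots$. Formulas: least set containing the atoms and closed under $\sim X$, $\neg X$, $X\supset Y$, $X\bullet Y$, $X\cup Y$, $X\equiv Y$. Abbreviations: $+X:=\neg\sim X$ and $*X:=(\neg X\cup +X)$. Alternate formulas $\underline X$: alternate atoms or formulas $\neg Y$. Axiom schemes: Ax1.1 $X\supset(Y\supset X)$; Ax1.2 $(X\supset(Y\supset Z))\supset((X\supset Y)\supset(X\supset Z))$; Ax1.3 $X\supset(X\cup Y)$; Ax1.4 $Y\supset(X\cup Y)$; Ax1.5 $(X\supset Z)\supset((Y\supset Z)\supset((X\cup Y)\supset Z))$; Ax1.6 $(X\bullet Y)\supset X$; Ax1.7 $(X\bullet Y)\supset Y$; Ax1.8 $(X\supset Y)\supset((X\supset Z)\supset(X\supset(Y\bullet Z)))$; Ax1.9 $X\supset(\sim X\supset Y)$; Ax1.10 $X\cup\sim X$; Ax1.11 $(X\equiv Y)\supset(X\supset Y)$; Ax1.12 $(X\equiv Y)\supset(Y\supset X)$; Ax1.13 $(X\supset Y)\supset((Y\supset X)\supset(X\equiv Y))$; Ax2.1 $(X\supset Y)\supset(+X\supset+Y)$; Ax2.2 $\neg X\supset\sim X$; Ax2.3 $\underline X\supset+\underline X$; Ax2.4 $+A$ for every instance $A$ of Ax1.1–Ax2.3. Rule: modus ponens.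 Theorems: formulas derivable from the axioms. -}

module Defs where

open import Data.Nat using (ℕ)

infixr 5 _⊃_
infixr 6 _∪_
infixr 7 _•_
infix 4 _≡ₗ_
data Formula : Set where
  cat  : ℕ → Formula
  aat  : ℕ → Formula
  ∼_   : Formula → Formula
  ¬ₗ_  : Formula → Formula
  _⊃_  : Formula → Formula → Formula
  _•_  : Formula → Formula → Formula
  _∪_  : Formula → Formula → Formula
  _≡ₗ_ : Formula → Formula → Formula

+_ : Formula → Formula
+ X = ¬ₗ (∼ X)

*_ : Formula → Formula
* X = (¬ₗ X) ∪ (+ X)

data Alternate : Formula → Set where
  alt-atom : ∀ n → Alternate (aat n)
  alt-neg  : ∀ Y → Alternate (¬ₗ Y)

data BaseAxiom : Formula → Set where
  ax1-1  : ∀ X Y → BaseAxiom (X ⊃ (Y ⊃ X))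
  ax1-2  : ∀ X Y Z → BaseAxiom ((X ⊃ (Y ⊃ Z)) ⊃ ((X ⊃ Y) ⊃ (X ⊃ Z)))
  ax1-3  : ∀ X Y → BaseAxiom (X ⊃ (X ∪ Y))
  ax1-4  : ∀ X Y → BaseAxiom (Y ⊃ (X ∪ Y))
  ax1-5  : ∀ X Y Z → BaseAxiom ((X ⊃ Z) ⊃ ((Y ⊃ Z) ⊃ ((X ∪ Y) ⊃ Z)))
  ax1-6  : ∀ X Y → BaseAxiom ((X • Y) ⊃ X)
  ax1-7  : ∀ X Y → BaseAxiom ((X • Y) ⊃ Y)
  ax1-8  : ∀ X Y Z → BaseAxiom ((X ⊃ Y) ⊃ ((X ⊃ Z) ⊃ (X ⊃ (Y • Z))))
  ax1-9  : ∀ X Y → BaseAxiom (X ⊃ ((∼ X) ⊃ Y))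
  ax1-10 : ∀ X → BaseAxiom (X ∪ (∼ X))
  ax1-11 : ∀ X Y → BaseAxiom ((X ≡ₗ Y) ⊃ (X ⊃ Y))
  ax1-12 : ∀ X Y → BaseAxiom ((X ≡ₗ Y) ⊃ (Y ⊃ X))
  ax1-13 : ∀ X Y → BaseAxiom ((X ⊃ Y) ⊃ ((Y ⊃ X) ⊃ (X ≡ₗ Y)))
  ax2-1  : ∀ X Y → BaseAxiom ((X ⊃ Y) ⊃ ((+ X) ⊃ (+ Y)))
  ax2-2  : ∀ X → BaseAxiom ((¬ₗ X) ⊃ (∼ X))
  ax2-3  : ∀ X → Alternate X → BaseAxiom (X ⊃ (+ X))

data Axiom : Formula → Set where
  base  : ∀ {A} → BaseAxiom A → Axiom A
  ax2-4 : ∀ {A} → BaseAxiom A → Axiom (+ A)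

data ⊢_ : Formula → Set where
  axiom : ∀ {A} → Axiom A → ⊢ A
  mp    : ∀ {A B} → ⊢ (A ⊃ B) → ⊢ A → ⊢ B

-- Since ¬ X ⊃ ∼ X (Ax2.2), the two disjuncts of * X = ¬ X ∪ + X are incompatible
-- with X and with ∼ X respectively, by Ax1.9 (+ X = ¬ ∼ X implies ∼ ∼ X, hence X).
-- So X together with * X leaves only + X, and ∼ X together with * X leaves only ¬ X;
-- conversely + X implies X and ¬ X implies ∼ X, and each implies the matching disjunct of * X.
{-# OPTIONS --safe #-}
module Submission where

open import Defs
open import Data.Product using (_×_; _,_)

ax : ∀ {A} → BaseAxiom A → ⊢ A
ax b = axiom (base b)

⊃-const : ∀ {A} B → ⊢ A → ⊢ (B ⊃ A)
⊃-const {A} B p = mp (ax (ax1-1 A B)) p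

⊃-app : ∀ {X Y Z} → ⊢ (X ⊃ (Y ⊃ Z)) → ⊢ (X ⊃ Y) → ⊢ (X ⊃ Z)
⊃-app {X} {Y} {Z} p q = mp (mp (ax (ax1-2 X Y Z)) p) q

⊃-trans : ∀ {X Y Z} → ⊢ (X ⊃ Y) → ⊢ (Y ⊃ Z) → ⊢ (X ⊃ Z)
⊃-trans {X} p q = ⊃-app (⊃-const X q) p

⊃-swap : ∀ {X Y Z} → ⊢ (X ⊃ (Y ⊃ Z)) → ⊢ (Y ⊃ (X ⊃ Z))
⊃-swap {X} {Y} {Z} p = ⊃-trans (ax (ax1-1 Y X)) (mp (ax (ax1-2 X Y Z)) p)

∪-elim : ∀ {X Y Z} → ⊢ (X ⊃ Z) → ⊢ (Y ⊃ Z) → ⊢ ((X ∪ Y) ⊃ Z)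
∪-elim {X} {Y} {Z} p q = mp (mp (ax (ax1-5 X Y Z)) p) q

•-intro : ∀ {X Y Z} → ⊢ (X ⊃ Y) → ⊢ (X ⊃ Z) → ⊢ (X ⊃ (Y • Z))
•-intro {X} {Y} {Z} p q = mp (mp (ax (ax1-8 X Y Z)) p) q

•-uncurry : ∀ {X Y Z} → ⊢ (X ⊃ (Y ⊃ Z)) → ⊢ ((X • Y) ⊃ Z)
•-uncurry {X} {Y} p = ⊃-app (⊃-trans (ax (ax1-6 X Y)) p) (ax (ax1-7 X Y))

≡ₗ-intro : ∀ {X Y} → ⊢ (X ⊃ Y) → ⊢ (Y ⊃ X) → ⊢ (X ≡ₗ Y)
≡ₗ-intro {X} {Y} p q = mp (mp (ax (ax1-13 X Y)) p) q

∼∼-elim : ∀ X → ⊢ ((∼ (∼ X)) ⊃ X)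
∼∼-elim X = mp (∪-elim (ax (ax1-1 X (∼ (∼ X)))) (ax (ax1-9 (∼ X) X))) (ax (ax1-10 X))

+-elim : ∀ X → ⊢ ((+ X) ⊃ X)
+-elim X = ⊃-trans (ax (ax2-2 (∼ X))) (∼∼-elim X)

*⇒[X⊃+X] : ∀ X → ⊢ ((* X) ⊃ (X ⊃ (+ X)))
*⇒[X⊃+X] X = ∪-elim (⊃-trans (ax (ax2-2 X)) (⊃-swap (ax (ax1-9 X (+ X)))))
                    (ax (ax1-1 (+ X) X))

*⇒[∼X⊃¬X] : ∀ X → ⊢ ((* X) ⊃ ((∼ X) ⊃ (¬ₗ X)))
*⇒[∼X⊃¬X] X = ∪-elim (ax (ax1-1 (¬ₗ X) (∼ X)))
                     (⊃-trans (+-elim X) (ax (ax1-9 X (¬ₗ X))))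

mainTheorem14 : (V F : Formula) →
    (⊢ ((V • (* V)) ≡ₗ (+ V))) × (⊢ (((∼ F) • (* F)) ≡ₗ (¬ₗ F)))
mainTheorem14 V F =
    ≡ₗ-intro (•-uncurry (⊃-swap (*⇒[X⊃+X] V)))
             (•-intro (+-elim V) (ax (ax1-4 (¬ₗ V) (+ V))))
  , ≡ₗ-intro (•-uncurry (⊃-swap (*⇒[∼X⊃¬X] F)))
             (•-intro (ax (ax2-2 F)) (ax (ax1-3 (¬ₗ F) (+ F))))
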